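{- Let $G,H$ be graphs with $H\leq_R G$ and let $\Phi\in\hom_R(G,H)$. For $I\in V(H)$ and $I_1,I_2\in(\partial\Phi)^{ -1}(I)$, we have $I_1\sim_\Phi I_2$ if and only if $I_1\cdot u=I_2\cdot u$ for every $u\in L_I(H)$ such that $(\partial\Phi)^{ -1}(I)\cdot u$ is a minimal image.
   Context: All graphs are finite directed graphs with state set $V(G)$, edge set $E(G)$, source/target maps $s,t$; loops and parallel edges allowed; all graphs sink-free. $E_I(G)=s^{ -1}(I)$, $L(G)$ finite edge paths, $L_I(G)$ those starting at $I$. A homomorphism consists of maps on edges and ($\partial\Phi$) on states commuting with $s,t$. A right-resolver is a surjective homomorphism with $\Phi|_{E_I(G)}:E_I(G)\to E_{\partial\Phi(I)}(H)$ bijective for all $I$; $\hom_R(G,H)$, $H\leq_R G$ if nonempty. For $u\in L_{\partial\Phi(I)}(H)$, $I\cdot u$ is the endpoint of the unique lift of $u$ starting at $I$; $U\cdot u=\{I\cdot u:I\in U\}$. Stability: $I_1\sim_\Phi I_2$ iff $\partial\Phi(I_1)=\partial\Phi(I_2)=:I$ and for every $u\in L_I(H)$ there is $v\in L_{t(u)}(H)$ with $I_1\cdot uv=I_2\cdot uv$. A minimal image is a set $U=(\partial\Phi)^{ -1}(I)\cdot u$ with $I\in V(H)$, $u\in L_I(H)$, such that $|U\cdot v|=|U|$ for every $v\in L_{t(u)}(H)$. -}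

module Defs where

open import Data.Nat using (ℕ; suc)
open import Data.Fin using (Fin; _≟_)
open import Data.Fin.Subset using (Subset; ∣_∣)
open import Data.Fin.Properties using (any?)
open import Data.Vec using (tabulate)
open import Data.Bool using (Bool; true; false)
open import Data.Product using (Σ; _×_; _,_; proj₁; proj₂; ∃)
open import Relation.Nullary using (Dec; yes; no; does)
open import Relation.Binary.PropositionalEquality using (_≡_; refl; sym; trans; cong)
open import Function.Bundles using (_⇔_)
open import Axiom.UniquenessOfIdentityProofs using (module Decidable⇒UIP)

record Graph : Set where
  field
    nV nE    : ℕ
    s t      : Fin nE → Fin nV
    sinkFree : (I : Fin nV) → Σ (Fin nE) λ e → s e ≡ I

open Graph public

V : Graph → Set
V G = Fin (nV G)

E : Graph → Set
E G = Fin (nE G)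

data Path (G : Graph) : V G → V G → Set where
  []  : {I : V G} → Path G I I
  _∷_ : {J : V G} (e : E G) → Path G (t G e) J → Path G (s G e) J

_++ₚ_ : {G : Graph} {I J K : V G} → Path G I J → Path G J K → Path G I K
[]      ++ₚ v = v
(e ∷ u) ++ₚ v = e ∷ (u ++ₚ v)

record Hom (G H : Graph) : Set where
  field
    Φ   : E G → E H
    ∂Φ  : V G → V H
    s-comm : (e : E G) → s H (Φ e) ≡ ∂Φ (s G e)
    t-comm : (e : E G) → t H (Φ e) ≡ ∂Φ (t G e)

open Hom public

Surjective : {A B : Set} → (A → B) → Set
Surjective {A} f = ∀ b → Σ A λ a → f a ≡ b

-- Right-resolver: surjective homomorphism (on edges and on states) whose
-- restriction E_I(G) → E_{∂Φ(I)}(H) is bijective for every state I.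
record RightResolver (G H : Graph) : Set where
  field
    hom     : Hom G H
    surjE   : Surjective (Φ hom)
    surjV   : Surjective (∂Φ hom)
    resolve : (I : V G) (f : E H) → s H f ≡ ∂Φ hom I →
              Σ (E G) λ e → s G e ≡ I × Φ hom e ≡ f
    resolveInj : (e₁ e₂ : E G) → s G e₁ ≡ s G e₂ → Φ hom e₁ ≡ Φ hom e₂ → e₁ ≡ e₂

open RightResolver public

homR : Graph → Graph → Set
homR = RightResolver

_≤R_ : Graph → Graph → Set
H ≤R G = RightResolver G H

module _ {G H : Graph} (R : RightResolver G H) where

  private
    h = hom R

  -- K · u  for u ∈ L_J(H) with ∂Φ(K) = J : endpoint of the unique lift of u
  -- starting at K.
  act : {J J' : V H} (K : V G) → ∂Φ h K ≡ J → Path H J J' → V G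
  act K p [] = K
  act K p (f ∷ u) =
    let r = resolve R K f (sym p)
        e = proj₁ r
    in act (t G e) (trans (sym (t-comm h e)) (cong (t H) (proj₂ (proj₂ r)))) u

  act-in-fiber : {J J' : V H} (K : V G) (p : ∂Φ h K ≡ J) (u : Path H J J') →
                 ∂Φ h (act K p u) ≡ J'
  act-in-fiber K p [] = p
  act-in-fiber K p (f ∷ u) = act-in-fiber _ _ u

  -- U · v for a set U of states (intended: U ⊆ (∂Φ)⁻¹(J)) and v ∈ L_J(H):
  -- { K · v : K ∈ U }.
  _·ₛ_ : {J J' : V H} → Subset (nV G) → Path H J J' → Subset (nV G)
  _·ₛ_ {J} U v = tabulate λ K' → does (any? λ K → dec K K')
    where
      open import Data.Vec using (lookup)
      open import Data.Bool using (T)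
      open import Relation.Nullary using (_×-dec_)
      open import Data.Bool using (_≟_)
      dec : (K K' : V G) → Dec (lookup U K ≡ true × Σ (∂Φ h K ≡ J) λ p → act K p v ≡ K')
      dec K K' with lookup U K Data.Bool.≟ true | ∂Φ h K Data.Fin.≟ J
      ... | no ¬a | _ = no λ x → ¬a (proj₁ x)
      ... | yes a | no ¬b = no λ x → ¬b (proj₁ (proj₂ x))
      ... | yes a | yes b with act K b v Data.Fin.≟ K'
      ...   | yes c = yes (a , b , c)
      ...   | no ¬c = no λ { (_ , b' , c') → ¬c (trans (cong (λ q → act K q v) (uip b b')) c') }
        where
          uip : {x y : V H} (q₁ q₂ : x ≡ y) → q₁ ≡ q₂
          uip = Decidable⇒UIP.≡-irrelevant Data.Fin._≟_

  fiber : V H → Subset (nV G)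
  fiber I = tabulate λ K → does (∂Φ h K Data.Fin.≟ I)

  fiberAct : {I J : V H} → Path H I J → Subset (nV G)
  fiberAct {I} u = fiber I ·ₛ u

  IsMinimalImage : Subset (nV G) → Set
  IsMinimalImage U =
    Σ (V H) λ I → Σ (V H) λ J → Σ (Path H I J) λ u →
      (U ≡ fiberAct u) ×
      ((J' : V H) (v : Path H J J') → ∣ U ·ₛ v ∣ ≡ ∣ U ∣)

  Stable : V G → V G → Set
  Stable I₁ I₂ =
    Σ (V H) λ I → Σ (∂Φ h I₁ ≡ I) λ p₁ → Σ (∂Φ h I₂ ≡ I) λ p₂ →
      (J : V H) (u : Path H I J) →
        Σ (V H) λ J' → Σ (Path H J J') λ v →
          act I₁ p₁ (u ++ₚ v) ≡ act I₂ p₂ (u ++ₚ v)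

-- Lifting a path can merge states of G but never split them, so the images
-- (∂Φ)⁻¹(I)·uv shrink as v grows, and an image is minimal exactly when no
-- further path merges two of its states.  Stable states can be merged after any
-- u; on a minimal image they must therefore already coincide.  Conversely every
-- path u extends to a path with minimal image, so states that coincide on all
-- minimal images are stable.  Constructively, the extension is found by
-- well-founded recursion on the size of the image, deciding at each step whether
-- a smaller image is reachable: this is reachability in the finite graph of pairs
-- (state of H, set of states of G), decidable because a shortest witness path
-- repeats no pair.
module Submission where

open import Axiom.UniquenessOfIdentityProofs using (module Decidable⇒UIP)
open import Data.Bool using (Bool; true)
open import Data.Empty using (⊥-elim)
open import Data.Fin using (Fin; zero; suc; _≟_)
open import Data.Fin.Properties using (any?; 2↔Bool; *↔×)
open import Data.Fin.Subset using (Subset; inside; outside; _∈_; _∉_; _⊆_; ⁅_⁆; _∪_; _─_; _-_; ∣_∣; Empty)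
open import Data.Fin.Subset.Properties
open import Data.Nat using (ℕ; zero; suc; _*_; _^_; _≤_; _<_; z≤n; s≤s)
open import Data.Nat.Induction using (<-wellFounded)
open import Data.Nat.Properties
  using (≤-reflexive; ≤-trans; ≤-<-trans; ≤-antisym; ≮⇒≥; m≤n⇒m≤1+n; <⇒≤; <⇒≢; _<?_)
open import Data.Product using (Σ; ∃; ∃₂; _×_; _,_)
open import Data.Product.Function.NonDependent.Propositional using (_×-↔_)
open import Data.Sum using (inj₁; inj₂)
open import Data.Unit using (⊤; tt)
open import Data.Vec using ([]; _∷_; lookup; tabulate; here; there)
open import Data.Vec.Properties using (lookup∘tabulate; []=⇒lookup; lookup⇒[]=)
open import Data.Vec.Recursive using (Fin[m^n]↔Fin[m]^n; lift↔)
open import Data.Vec.Recursive.Properties using (↔Vec)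
open import Function using (_∘_)
open import Function.Bundles using (_⇔_; _↔_; _↣_; mk⇔; Equivalence; Injection)
open import Function.Construct.Composition using (_↔-∘_)
open import Function.Construct.Identity using (↔-id)
open import Function.Construct.Symmetry using (↔-sym)
open import Function.Properties.Inverse using (↔⇒↣)
open import Induction.WellFounded using (Acc; acc)
open import Level using (0ℓ)
open import Relation.Binary using (Rel)
open import Relation.Binary.Construct.Closure.ReflexiveTransitive using (Star; ε; _◅_)
open import Relation.Binary.PropositionalEquality
open import Relation.Nullary using (¬_; Dec; yes; no; does; contradiction)
open import Relation.Nullary.Decidable using (map′; _×-dec_; dec-true)
open import Relation.Unary using (Pred; Decidable)

open import Defs

x∈p─q⇒x∉q : ∀ {n} {x : Fin n} {p q : Subset n} → x ∈ p ─ q → x ∉ q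
x∈p─q⇒x∉q {x = zero} {_ ∷ _} {inside ∷ _} () _
x∈p─q⇒x∉q {x = zero} {_ ∷ _} {outside ∷ _} _ ()
x∈p─q⇒x∉q {x = suc _} {_ ∷ _} {_ ∷ _} (there x∈p─q) (there x∈q) = x∈p─q⇒x∉q x∈p─q x∈q

∣p∣≤1+∣p-x∣ : ∀ {n} (p : Subset n) (x : Fin n) → ∣ p ∣ ≤ suc ∣ p - x ∣
∣p∣≤1+∣p-x∣ (inside  ∷ p) zero    = s≤s (≤-reflexive (cong ∣_∣ (sym (p─⊥≡p p))))
∣p∣≤1+∣p-x∣ (outside ∷ p) zero    = m≤n⇒m≤1+n (≤-reflexive (cong ∣_∣ (sym (p─⊥≡p p))))
∣p∣≤1+∣p-x∣ (inside  ∷ p) (suc x) = s≤s (∣p∣≤1+∣p-x∣ p x)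
∣p∣≤1+∣p-x∣ (outside ∷ p) (suc x) = ∣p∣≤1+∣p-x∣ p x

x∉p⇒∣⁅x⁆∪p∣≡1+∣p∣ : ∀ {n} {x : Fin n} (p : Subset n) → x ∉ p → ∣ ⁅ x ⁆ ∪ p ∣ ≡ suc ∣ p ∣
x∉p⇒∣⁅x⁆∪p∣≡1+∣p∣ {x = zero}  (inside  ∷ p) x∉p = ⊥-elim (x∉p here)
x∉p⇒∣⁅x⁆∪p∣≡1+∣p∣ {x = zero}  (outside ∷ p) x∉p = cong (suc ∘ ∣_∣) (∪-identityˡ p)
x∉p⇒∣⁅x⁆∪p∣≡1+∣p∣ {x = suc x} (inside  ∷ p) x∉p = cong suc (x∉p⇒∣⁅x⁆∪p∣≡1+∣p∣ p (x∉p ∘ there))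
x∉p⇒∣⁅x⁆∪p∣≡1+∣p∣ {x = suc x} (outside ∷ p) x∉p = x∉p⇒∣⁅x⁆∪p∣≡1+∣p∣ p (x∉p ∘ there)

infix 4 _⊆⟦_⟧_
_⊆⟦_⟧_ : ∀ {m n} → Subset n → (Fin m → Fin n) → Subset m → Set
q ⊆⟦ f ⟧ p = ∀ {y} → y ∈ q → ∃ λ x → x ∈ p × f x ≡ y

q⊆f[p]⇒∣q∣≤∣p∣ : ∀ {m n} (f : Fin m → Fin n) (p : Subset m) (q : Subset n) →
                  q ⊆⟦ f ⟧ p → ∣ q ∣ ≤ ∣ p ∣
q⊆f[p]⇒∣q∣≤∣p∣ {n = n} f [] q q⊆fp =
  ≤-reflexive (trans (cong ∣_∣ (Empty-unique q-empty)) (∣⊥∣≡0 n))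
  where
  q-empty : Empty q
  q-empty (_ , y∈q) with q⊆fp y∈q
  ... | () , _
q⊆f[p]⇒∣q∣≤∣p∣ f (outside ∷ p) q q⊆fp = q⊆f[p]⇒∣q∣≤∣p∣ (f ∘ suc) p q q⊆fsp
  where
  q⊆fsp : q ⊆⟦ f ∘ suc ⟧ p
  q⊆fsp y∈q with q⊆fp y∈q
  ... | suc x , there x∈p , fx≡y = x , x∈p , fx≡y
q⊆f[p]⇒∣q∣≤∣p∣ f (inside ∷ p) q q⊆fp =
  ≤-trans (∣p∣≤1+∣p-x∣ q (f zero)) (s≤s (q⊆f[p]⇒∣q∣≤∣p∣ (f ∘ suc) p (q - f zero) q-f0⊆fsp))
  where
  q-f0⊆fsp : q - f zero ⊆⟦ f ∘ suc ⟧ p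
  q-f0⊆fsp y∈q-f0 with q⊆fp (p─q⊆p q _ y∈q-f0)
  ... | zero  , _         , f0≡y = ⊥-elim (x∉⁅y⁆⇒x≢y (x∈p─q⇒x∉q y∈q-f0) (sym f0≡y))
  ... | suc x , there x∈p , fx≡y = x , x∈p , fx≡y

∈tabulate⇔ : ∀ {n} {f : Fin n → Bool} {x} → x ∈ tabulate f ⇔ f x ≡ true
∈tabulate⇔ {f = f} {x} = mk⇔
  (λ x∈ → trans (sym (lookup∘tabulate f x)) ([]=⇒lookup x∈))
  (λ fx≡true → lookup⇒[]= x _ (trans (lookup∘tabulate f x) fx≡true))

does≡true⇒ : ∀ {a} {A : Set a} (a? : Dec A) → does a? ≡ true → A
does≡true⇒ (yes a) _ = a

Subset↔Fin : ∀ n → Subset n ↔ Fin (2 ^ n)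
Subset↔Fin n = ↔-sym (↔Vec n ↔-∘ (lift↔ n 2↔Bool ↔-∘ Fin[m^n]↔Fin[m]^n 2 n))

×Subset↔Fin : ∀ m n → (Fin m × Subset n) ↔ Fin (m * 2 ^ n)
×Subset↔Fin m n = ↔-sym *↔× ↔-∘ (↔-id (Fin m) ×-↔ Subset↔Fin n)

module FiniteReachability {X : Set} {N : ℕ} (code : X ↣ Fin N) (Step : Rel X 0ℓ)
  (successor? : ∀ x {P : Pred X 0ℓ} → Decidable P → Dec (∃ λ y → Step x y × P y)) where

  open Injection code using () renaming (to to enc; injective to enc-injective)

  length : ∀ {x y} → Star Step x y → ℕ
  length ε       = zero
  length (_ ◅ r) = suc (length r)

  visited : ∀ {x y} → Star Step x y → Subset N
  visited {x} ε       = ⁅ enc x ⁆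
  visited {x} (_ ◅ r) = ⁅ enc x ⁆ ∪ visited r

  Simple : ∀ {x y} → Star Step x y → Set
  Simple ε           = ⊤
  Simple {x} (_ ◅ r) = enc x ∉ visited r × Simple r

  ∣visited∣≡1+length : ∀ {x y} (r : Star Step x y) → Simple r → ∣ visited r ∣ ≡ suc (length r)
  ∣visited∣≡1+length {x} ε       _               = ∣⁅x⁆∣≡1 (enc x)
  ∣visited∣≡1+length     (_ ◅ r) (x∉r , simple) =
    trans (x∉p⇒∣⁅x⁆∪p∣≡1+∣p∣ (visited r) x∉r) (cong suc (∣visited∣≡1+length r simple))

  simple⇒length<N : ∀ {x y} (r : Star Step x y) → Simple r → length r < N
  simple⇒length<N r simple = ≤-trans (≤-reflexive (sym (∣visited∣≡1+length r simple))) (∣p∣≤n (visited r))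

  dropUntil : ∀ {x y z} (r : Star Step x y) → Simple r → enc z ∈ visited r → Σ (Star Step z y) Simple
  dropUntil {x} ε _ z∈r with enc-injective (x∈⁅y⁆⇒x≡y (enc x) z∈r)
  ... | refl = ε , tt
  dropUntil {x} (step ◅ r) (x∉r , simple) z∈step◅r with x∈p∪q⁻ ⁅ enc x ⁆ (visited r) z∈step◅r
  ... | inj₂ z∈r = dropUntil r simple z∈r
  ... | inj₁ z∈x with enc-injective (x∈⁅y⁆⇒x≡y (enc x) z∈x)
  ...   | refl = step ◅ r , x∉r , simple

  simplify : ∀ {x y} → Star Step x y → Σ (Star Step x y) Simple
  simplify ε = ε , tt
  simplify {x} (step ◅ r) with simplify r
  ... | r′ , simple with enc x ∈? visited r′
  ...   | yes x∈r′ = dropUntil r′ simple x∈r′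
  ...   | no  x∉r′ = step ◅ r′ , x∉r′ , simple

  module _ (P : Pred X 0ℓ) where

    ReachableWithin : ℕ → Pred X 0ℓ
    ReachableWithin k x = ∃₂ λ y (r : Star Step x y) → length r ≤ k × P y

    Reachable : Pred X 0ℓ
    Reachable x = ∃ λ y → Star Step x y × P y

  module _ {P : Pred X 0ℓ} (P? : Decidable P) where

    reachableWithin? : ∀ k → Decidable (ReachableWithin P k)
    reachableWithin? k x with P? x
    ... | yes Px = yes (x , ε , z≤n , Px)
    reachableWithin? zero x | no ¬Px =
      no λ { (_ , ε , _ , Px) → ¬Px Px ; (_ , _ ◅ _ , () , _) }
    reachableWithin? (suc k) x | no ¬Px = map′ extend shrink (successor? x (reachableWithin? k))
      where
      extend : (∃ λ y → Step x y × ReachableWithin P k y) → ReachableWithin P (suc k) x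
      extend (_ , step , z , r , r≤k , Pz) = z , step ◅ r , s≤s r≤k , Pz
      shrink : ReachableWithin P (suc k) x → ∃ λ y → Step x y × ReachableWithin P k y
      shrink (_ , ε        , _         , Px) = ⊥-elim (¬Px Px)
      shrink (z , step ◅ r , s≤s r≤k , Pz) = _ , step , z , r , r≤k , Pz

    reachable? : Decidable (Reachable P)
    reachable? x = map′ forget bound (reachableWithin? N x)
      where
      forget : ReachableWithin P N x → Reachable P x
      forget (y , r , _ , Py) = y , r , Py
      bound : Reachable P x → ReachableWithin P N x
      bound (y , r , Py) with simplify r
      ... | r′ , simple = y , r′ , <⇒≤ (simple⇒length<N r′ simple) , Py

++ₚ-identityʳ : ∀ {G : Graph} {I J} (u : Path G I J) → u ++ₚ [] ≡ u
++ₚ-identityʳ []      = refl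
++ₚ-identityʳ (e ∷ u) = cong (e ∷_) (++ₚ-identityʳ u)

++ₚ-assoc : ∀ {G : Graph} {I J K L} (u : Path G I J) (v : Path G J K) (w : Path G K L) →
            (u ++ₚ v) ++ₚ w ≡ u ++ₚ (v ++ₚ w)
++ₚ-assoc []      v w = refl
++ₚ-assoc (e ∷ u) v w = cong (e ∷_) (++ₚ-assoc u v w)

module _ {G H : Graph} (R : RightResolver G H) where

  private
    ∂ : V G → V H
    ∂ = ∂Φ (hom R)

    infixl 5 _·_
    _·_ : ∀ {J J'} → Subset (nV G) → Path H J J' → Subset (nV G)
    _·_ = _·ₛ_ R

  act-irrelevant : ∀ {J J'} K (p q : ∂ K ≡ J) (u : Path H J J') → act R K p u ≡ act R K q u
  act-irrelevant K p q u = cong (λ r → act R K r u) (Decidable⇒UIP.≡-irrelevant _≟_ p q)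

  act-++ : ∀ {J J' J''} K (p : ∂ K ≡ J) (u : Path H J J') (v : Path H J' J'') →
           act R K p (u ++ₚ v) ≡ act R (act R K p u) (act-in-fiber R K p u) v
  act-++ K p []      v = refl
  act-++ K p (f ∷ u) v = act-++ _ _ u v

  ∂≡⇒∈fiber : ∀ {I K} → ∂ K ≡ I → K ∈ fiber R I
  ∂≡⇒∈fiber {I} {K} = Equivalence.from ∈tabulate⇔ ∘ dec-true (∂ K ≟ I)

  ∈·⁻ : ∀ {J J' K'} (U : Subset (nV G)) (v : Path H J J') → K' ∈ U · v →
        ∃ λ K → K ∈ U × Σ (∂ K ≡ J) λ p → act R K p v ≡ K'
  ∈·⁻ {J} {K' = K'} U v K'∈U·v = lookup-true⇒∈ (does≡true⇒ (any? _) (Equivalence.to ∈tabulate⇔ K'∈U·v))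
    where
    lookup-true⇒∈ : (∃ λ K → lookup U K ≡ true × Σ (∂ K ≡ J) λ p → act R K p v ≡ K') →
                    ∃ λ K → K ∈ U × Σ (∂ K ≡ J) λ p → act R K p v ≡ K'
    lookup-true⇒∈ (K , UK≡true , p , K·v≡K') = K , lookup⇒[]= K U UK≡true , p , K·v≡K'

  ∈·⁺ : ∀ {J J' K} (U : Subset (nV G)) (v : Path H J J') (p : ∂ K ≡ J) → K ∈ U → act R K p v ∈ U · v
  ∈·⁺ {K = K} U v p K∈U =
    Equivalence.from ∈tabulate⇔ (dec-true (any? _) (K , []=⇒lookup K∈U , p , refl))

  ∈·⇒∂≡ : ∀ {J J' K'} (U : Subset (nV G)) (v : Path H J J') → K' ∈ U · v → ∂ K' ≡ J'
  ∈·⇒∂≡ U v K'∈U·v with ∈·⁻ U v K'∈U·v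
  ... | K , _ , p , refl = act-in-fiber R K p v

  act∈fiberAct : ∀ {I J K} (p : ∂ K ≡ I) (u : Path H I J) → act R K p u ∈ fiberAct R u
  act∈fiberAct p u = ∈·⁺ _ u p (∂≡⇒∈fiber p)

  ·-++ : ∀ {J J' J''} (U : Subset (nV G)) (a : Path H J J') (b : Path H J' J'') → U · a · b ≡ U · (a ++ₚ b)
  ·-++ U a b = ⊆-antisym to from
    where
    to : U · a · b ⊆ U · (a ++ₚ b)
    to K''∈ with ∈·⁻ (U · a) b K''∈
    ... | K' , K'∈ , q , refl with ∈·⁻ U a K'∈
    ...   | K , K∈U , p , refl =
      subst (_∈ U · (a ++ₚ b)) (trans (act-++ K p a b) (act-irrelevant _ _ q b)) (∈·⁺ U (a ++ₚ b) p K∈U)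
    from : U · (a ++ₚ b) ⊆ U · a · b
    from K''∈ with ∈·⁻ U (a ++ₚ b) K''∈
    ... | K , K∈U , p , refl =
      subst (_∈ U · a · b) (sym (act-++ K p a b)) (∈·⁺ (U · a) b _ (∈·⁺ U a p K∈U))

  -- The action made total (the identity off the fibre over J), so that the
  -- counting lemma q⊆f[p]⇒∣q∣≤∣p∣ applies to it.
  actOrStay : ∀ {J J'} → Path H J J' → V G → V G
  actOrStay {J} v K with ∂ K ≟ J
  ... | yes p = act R K p v
  ... | no  _ = K

  actOrStay≡act : ∀ {J J'} (v : Path H J J') K (p : ∂ K ≡ J) → actOrStay v K ≡ act R K p v
  actOrStay≡act {J} v K p with ∂ K ≟ J
  ... | yes p′ = act-irrelevant K p′ p v
  ... | no ¬p  = contradiction p ¬p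

  ·⊆⟦actOrStay⟧ : ∀ {J J'} (U : Subset (nV G)) (v : Path H J J') → U · v ⊆⟦ actOrStay v ⟧ U
  ·⊆⟦actOrStay⟧ U v K'∈U·v with ∈·⁻ U v K'∈U·v
  ... | K , K∈U , p , K·v≡K' = K , K∈U , trans (actOrStay≡act v K p) K·v≡K'

  ∣U·v∣≤∣U∣ : ∀ {J J'} (U : Subset (nV G)) (v : Path H J J') → ∣ U · v ∣ ≤ ∣ U ∣
  ∣U·v∣≤∣U∣ U v = q⊆f[p]⇒∣q∣≤∣p∣ (actOrStay v) U (U · v) (·⊆⟦actOrStay⟧ U v)

  merge⇒∣U·v∣<∣U∣ : ∀ {J J' K₁ K₂} (U : Subset (nV G)) (v : Path H J J')
                      (p₁ : ∂ K₁ ≡ J) (p₂ : ∂ K₂ ≡ J) → K₁ ∈ U → K₂ ∈ U → K₁ ≢ K₂ →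
                      act R K₁ p₁ v ≡ act R K₂ p₂ v → ∣ U · v ∣ < ∣ U ∣
  merge⇒∣U·v∣<∣U∣ {K₁ = K₁} {K₂} U v p₁ p₂ K₁∈U K₂∈U K₁≢K₂ merged =
    ≤-<-trans (q⊆f[p]⇒∣q∣≤∣p∣ (actOrStay v) (U - K₂) (U · v) ·⊆⟦actOrStay⟧U-K₂) (x∈p⇒∣p-x∣<∣p∣ K₂∈U)
    where
    ·⊆⟦actOrStay⟧U-K₂ : U · v ⊆⟦ actOrStay v ⟧ (U - K₂)
    ·⊆⟦actOrStay⟧U-K₂ K'∈U·v with ·⊆⟦actOrStay⟧ U v K'∈U·v
    ... | K , K∈U , K↦K' with K ≟ K₂
    ...   | no K≢K₂ = K , x∈p∧x≢y⇒x∈p-y K∈U K≢K₂ , K↦K'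
    ...   | yes refl = K₁ , x∈p∧x≢y⇒x∈p-y K₁∈U K₁≢K₂ , (begin
      actOrStay v K₁   ≡⟨ actOrStay≡act v K₁ p₁ ⟩
      act R K₁ p₁ v    ≡⟨ merged ⟩
      act R K₂ p₂ v    ≡⟨ sym (actOrStay≡act v K₂ p₂) ⟩
      actOrStay v K₂   ≡⟨ K↦K' ⟩
      _                ∎)
      where open ≡-Reasoning

  minimalImage-act-injective : ∀ {U J J' K₁ K₂} → IsMinimalImage R U → K₁ ∈ U → K₂ ∈ U →
                               (p₁ : ∂ K₁ ≡ J) (p₂ : ∂ K₂ ≡ J) (v : Path H J J') →
                               act R K₁ p₁ v ≡ act R K₂ p₂ v → K₁ ≡ K₂
  minimalImage-act-injective {K₁ = K₁} {K₂} (_ , _ , u , refl , minimal) K₁∈U K₂∈U p₁ p₂ v merged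
    -- K₁ lies over J and over the endpoint of u, which identifies the two.
    with trans (sym p₁) (∈·⇒∂≡ (fiber R _) u K₁∈U)
  ... | refl with K₁ ≟ K₂
  ...   | yes K₁≡K₂ = K₁≡K₂
  ...   | no  K₁≢K₂ =
    contradiction (minimal _ v) (<⇒≢ (merge⇒∣U·v∣<∣U∣ (fiberAct R u) v p₁ p₂ K₁∈U K₂∈U K₁≢K₂ merged))

  stable⇒mergeable : ∀ {I J K₁ K₂} → Stable R K₁ K₂ → (p₁ : ∂ K₁ ≡ I) (p₂ : ∂ K₂ ≡ I) (u : Path H I J) →
                     ∃₂ λ J' (v : Path H J J') → act R (act R K₁ p₁ u) (act-in-fiber R K₁ p₁ u) v
                                                 ≡ act R (act R K₂ p₂ u) (act-in-fiber R K₂ p₂ u) v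
  stable⇒mergeable {K₁ = K₁} {K₂} (_ , q₁ , q₂ , stable) p₁ p₂ u with trans (sym p₁) q₁
  ... | refl with stable _ u
  ...   | J' , v , merged = J' , v , (begin
    act R (act R K₁ p₁ u) _ v  ≡⟨ sym (act-++ K₁ p₁ u v) ⟩
    act R K₁ p₁ (u ++ₚ v)      ≡⟨ act-irrelevant K₁ p₁ q₁ (u ++ₚ v) ⟩
    act R K₁ q₁ (u ++ₚ v)      ≡⟨ merged ⟩
    act R K₂ q₂ (u ++ₚ v)      ≡⟨ act-irrelevant K₂ q₂ p₂ (u ++ₚ v) ⟩
    act R K₂ p₂ (u ++ₚ v)      ≡⟨ act-++ K₂ p₂ u v ⟩
    act R (act R K₂ p₂ u) _ v  ∎)
    where open ≡-Reasoning

  ImageState : Set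
  ImageState = V H × Subset (nV G)

  data ImageStep : Rel ImageState 0ℓ where
    along : ∀ f U → ImageStep (s H f , U) (t H f , U · (f ∷ []))

  imageSuccessor? : ∀ x {P : Pred ImageState 0ℓ} → Decidable P → Dec (∃ λ y → ImageStep x y × P y)
  imageSuccessor? (J , U) P? = map′ from to (any? λ f → (s H f ≟ J) ×-dec P? (t H f , U · (f ∷ [])))
    where
    from : ∃ (λ f → s H f ≡ J × _) → ∃ λ y → ImageStep (J , U) y × _
    from (f , refl , Py) = _ , along f U , Py
    to : (∃ λ y → ImageStep (J , U) y × _) → ∃ (λ f → s H f ≡ J × _)
    to (_ , along f _ , Py) = f , refl , Py

  open FiniteReachability (↔⇒↣ (×Subset↔Fin (nV H) (nV G))) ImageStep imageSuccessor?

  -- Stated for images U · w because U · [] is only the part of U over J.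
  path⇒star : ∀ {I J J'} (U : Subset (nV G)) (w : Path H I J) (v : Path H J J') →
              Star ImageStep (J , U · w) (J' , U · (w ++ₚ v))
  path⇒star {J = J} U w [] =
    subst (λ w′ → Star ImageStep (J , U · w) (J , U · w′)) (sym (++ₚ-identityʳ w)) ε
  path⇒star U w (f ∷ v) =
    along f (U · w) ◅ subst₂ (λ A w′ → Star ImageStep (t H f , A) (_ , U · w′))
                              (sym (·-++ U w (f ∷ []))) (++ₚ-assoc w (f ∷ []) v)
                              (path⇒star U (w ++ₚ (f ∷ [])) v)

  star⇒path : ∀ {I J J' U₀ U'} (U : Subset (nV G)) (w : Path H I J) → U₀ ≡ U · w →
              Star ImageStep (J , U₀) (J' , U') → ∃ λ (v : Path H J J') → U' ≡ U · (w ++ₚ v)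
  star⇒path U w U₀≡U·w ε = [] , trans U₀≡U·w (cong (U ·_) (sym (++ₚ-identityʳ w)))
  star⇒path U w refl (along f _ ◅ r) with star⇒path U (w ++ₚ (f ∷ [])) (·-++ U w (f ∷ [])) r
  ... | v , U'≡ = f ∷ v , trans U'≡ (cong (U ·_) (++ₚ-assoc w (f ∷ []) v))

  module _ (I : V H) where

    SmallerThan : ℕ → Pred ImageState 0ℓ
    SmallerThan n (_ , U) = ∣ U ∣ < n

    smallerThan? : ∀ n → Decidable (SmallerThan n)
    smallerThan? n (_ , U) = ∣ U ∣ <? n

    unshrinkable⇒minimal : ∀ {J} (u : Path H I J) →
                           ¬ Reachable (SmallerThan ∣ fiberAct R u ∣) (J , fiberAct R u) →
                           IsMinimalImage R (fiberAct R u)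
    unshrinkable⇒minimal u unshrinkable = I , _ , u , refl , λ _ v →
      ≤-antisym (∣U·v∣≤∣U∣ (fiberAct R u) v) (≮⇒≥ λ smaller →
        unshrinkable (_ , path⇒star (fiber R I) u v , subst (λ A → ∣ A ∣ < _) (·-++ (fiber R I) u v) smaller))

    minimalExtension : ∀ {J} (u : Path H I J) →
                       ∃₂ λ J' (w : Path H J J') → IsMinimalImage R (fiberAct R (u ++ₚ w))
    minimalExtension u = extend u (<-wellFounded _)
      where
      extend : ∀ {J} (u : Path H I J) → Acc _<_ ∣ fiberAct R u ∣ →
               ∃₂ λ J' (w : Path H J J') → IsMinimalImage R (fiberAct R (u ++ₚ w))
      extend {J} u (acc smaller⇒acc)
        with reachable? (smallerThan? ∣ fiberAct R u ∣) (J , fiberAct R u)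
      ... | no unshrinkable =
        J , [] , subst (IsMinimalImage R ∘ fiberAct R) (sym (++ₚ-identityʳ u)) (unshrinkable⇒minimal u unshrinkable)
      ... | yes (_ , r , smaller) with star⇒path (fiber R I) u refl r
      ...   | v , refl with extend (u ++ₚ v) (smaller⇒acc smaller)
      ...     | J' , w , minimal =
        J' , v ++ₚ w , subst (IsMinimalImage R ∘ fiberAct R) (++ₚ-assoc u v w) minimal

lemma3p16 : (G H : Graph) → H ≤R G → (R : homR G H) →
    (I : V H) (I₁ I₂ : V G) (p₁ : ∂Φ (hom R) I₁ ≡ I) (p₂ : ∂Φ (hom R) I₂ ≡ I) →
    Stable R I₁ I₂ ⇔
    ((J : V H) (u : Path H I J) → IsMinimalImage R (fiberAct R u) →
    act R I₁ p₁ u ≡ act R I₂ p₂ u)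
lemma3p16 G H _ R I I₁ I₂ p₁ p₂ = mk⇔ stable⇒synchronized synchronized⇒stable
  where
  stable⇒synchronized : Stable R I₁ I₂ → (J : V H) (u : Path H I J) → IsMinimalImage R (fiberAct R u) →
                        act R I₁ p₁ u ≡ act R I₂ p₂ u
  stable⇒synchronized stable J u minimal =
    let _ , v , merged = stable⇒mergeable R stable p₁ p₂ u
    in minimalImage-act-injective R minimal (act∈fiberAct R p₁ u) (act∈fiberAct R p₂ u) _ _ v merged

  synchronized⇒stable : ((J : V H) (u : Path H I J) → IsMinimalImage R (fiberAct R u) →
                         act R I₁ p₁ u ≡ act R I₂ p₂ u) → Stable R I₁ I₂
  synchronized⇒stable synchronized = I , p₁ , p₂ , λ J u →
    let J' , w , minimal = minimalExtension R I u in J' , w , synchronized J' (u ++ₚ w) minimal
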